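{- Let $G$ be a connected graph with vertex set $\{1,\ldots,n\}$ whose distance matrix $\mathbf{D}$ is nonsingular, and let $k\ge1$. A nonnegative vector $\boldsymbol{\rho}\in\mathbb{R}^n$ is $(G,k)$-feasible if and only if $\mathbf{x}=\boldsymbol{\rho}\mathbf{D}^{ -1}$ is a vector of nonnegative integers whose components sum to $k$.
   Context: For a graph $G$ with vertex set $\{1,\ldots,n\}$ and $k\ge1$, the $k$-supertoken graph $\mathcal{F}_k(G)$ has as vertices all vectors $\mathbf{x}=(x_1,\ldots,x_n)$ of nonnegative integers with $\sum_i x_i=k$, with $\mathbf{x},\mathbf{y}$ adjacent iff $\mathbf{y}=\mathbf{x}-\mathbf{e}_i+\mathbf{e}_j$ for some edge $\{i,j\}$ of $G$ with $x_i\ge1$. Let $C=\{\mathbf{z}_1,\ldots,\mathbf{z}_n\}$ with $\mathbf{z}_j=k\mathbf{e}_j$. The distance matrix $\mathbf{D}$ has entries $\operatorname{dist}_G(i,j)$. A nonnegative vector $\boldsymbol{\rho}=(\rho_1,\ldots,\rho_n)$ is $(G,k)$-feasible if there is a vertex $\mathbf{x}$ of $\mathcal{F}_k(G)$ with $(\operatorname{dist}_{\mathcal{F}_k(G)}(\mathbf{x},\mathbf{z}_1),\ldots,\operatorname{dist}_{\mathcal{F}_k(G)}(\mathbf{x},\mathbf{z}_n))=\boldsymbol{\rho}$.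
   Formalization: The nonnegative vector ρ has rational entries, ranging over ℚ^n instead of ℝ^n. -}

module Defs where

open import Data.Nat as ℕ using (ℕ; zero; suc; _∸_; _≤_)
open import Data.Fin using (Fin; zero; suc; _≟_)
open import Data.Vec using (Vec; lookup; tabulate; sum)
open import Data.Product using (Σ; ∃; _×_; ∃-syntax)
open import Data.Integer using (+_)
open import Data.Rational as ℚ using (ℚ; 0ℚ; 1ℚ)
open import Relation.Nullary using (¬_; yes; no)
open import Relation.Binary.PropositionalEquality using (_≡_)

record SimpleGraph (n : ℕ) : Set₁ where
  field
    Adj    : Fin n → Fin n → Set
    sym    : ∀ {i j} → Adj i j → Adj j i
    irrefl : ∀ {i} → ¬ Adj i i
open SimpleGraph public

data Walk {A : Set} (R : A → A → Set) : A → A → ℕ → Set where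
  here : ∀ {a} → Walk R a a zero
  step : ∀ {a b c ℓ} → R a b → Walk R b c ℓ → Walk R a c (suc ℓ)

IsDist : {A : Set} (R : A → A → Set) → A → A → ℕ → Set
IsDist R a b d = Walk R a b d × (∀ m → Walk R a b m → d ≤ m)

Connected : ∀ {n} → SimpleGraph n → Set
Connected {n} G = ∀ (i j : Fin n) → ∃[ d ] Walk (Adj G) i j d

IsDistanceMatrix : ∀ {n} → SimpleGraph n → (Fin n → Fin n → ℕ) → Set
IsDistanceMatrix {n} G D = ∀ (i j : Fin n) → IsDist (Adj G) i j (D i j)

δ : ∀ {n} → Fin n → Fin n → ℕ
δ i l with i ≟ l
... | yes _ = 1
... | no  _ = 0

-- Adjacency in the supertoken graph: y = x - e_i + e_j for an edge {i,j} with x_i ≥ 1.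
-- (Walks from a vertex with coordinate sum k stay among such vertices, so distances
-- computed with this relation on Vec ℕ n are distances in F_k(G).)
STAdj : ∀ {n} → SimpleGraph n → Vec ℕ n → Vec ℕ n → Set
STAdj {n} G x y = Σ (Fin n) λ i → Σ (Fin n) λ j →
  Adj G i j × (1 ≤ lookup x i) × (y ≡ tabulate (λ l → (lookup x l ∸ δ i l) ℕ.+ δ j l))

zvec : ∀ {n} → ℕ → Fin n → Vec ℕ n
zvec k j = tabulate (λ l → k ℕ.* δ j l)

IsSupertokenVertex : ∀ {n} → ℕ → Vec ℕ n → Set
IsSupertokenVertex k x = sum x ≡ k

ℕtoℚ : ℕ → ℚ
ℕtoℚ m = (+ m) ℚ./ 1

Feasible : ∀ {n} → SimpleGraph n → ℕ → (Fin n → ℚ) → Set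
Feasible {n} G k ρ = ∃[ x ] (IsSupertokenVertex k x ×
  (∀ (j : Fin n) → ∃[ d ] (IsDist (STAdj G) x (zvec k j) d × ρ j ≡ ℕtoℚ d)))

Σℚ : ∀ {n} → (Fin n → ℚ) → ℚ
Σℚ {zero}  f = 0ℚ
Σℚ {suc n} f = f zero ℚ.+ Σℚ (λ i → f (suc i))

δℚ : ∀ {n} → Fin n → Fin n → ℚ
δℚ i j = ℕtoℚ (δ i j)

IsInverse : ∀ {n} → (Fin n → Fin n → ℕ) → (Fin n → Fin n → ℚ) → Set
IsInverse D Dinv =
  (∀ i j → Σℚ (λ l → ℕtoℚ (D i l) ℚ.* Dinv l j) ≡ δℚ i j) ×
  (∀ i j → Σℚ (λ l → Dinv i l ℚ.* ℕtoℚ (D l j)) ≡ δℚ i j)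

_·ᵣ_ : ∀ {n} → (Fin n → ℚ) → (Fin n → Fin n → ℚ) → (Fin n → ℚ)
(ρ ·ᵣ M) j = Σℚ (λ i → ρ i ℚ.* M i j)

-- Write Φⱼ(x) = Σₗ xₗ D(l,j) = (xD)ⱼ. Along an edge D(·,j) changes by at most 1, so a move
-- of one token changes Φⱼ by at most 1, and Φⱼ(zⱼ) = 0; hence Φⱼ(x) ≤ dist(x, zⱼ). Conversely
-- every configuration x ≠ zⱼ has a token at some l ≠ j, and moving it to the next vertex of a
-- shortest path from l to j lowers Φⱼ by exactly 1; hence dist(x, zⱼ) = (xD)ⱼ. So the distance
-- vector of x is xD, and since D is invertible, ρ is realised exactly by x = ρD⁻¹.
module Submission where

open import Defs hiding (sym)
open import Algebra.Bundles using (CommutativeMonoid; Ring)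
import Algebra.Properties.CommutativeMonoid.Sum as CommutativeMonoidSum
import Algebra.Properties.Semiring.Sum as SemiringSum
open import Data.Nat as ℕ using (ℕ; zero; suc; _+_; _*_; _∸_; _≤_; z≤n; s≤s; s≤s⁻¹; NonZero)
open import Data.Nat.Tactic.RingSolver using (solve-∀)
import Data.Nat.Properties as ℕₚ
import Data.Integer as ℤ
import Data.Integer.Properties as ℤₚ
open import Data.Fin using (Fin; zero; suc; _≟_; punchIn)
open import Data.Fin.Properties using (punchInᵢ≢i)
open import Data.Vec using (Vec; []; _∷_; lookup; tabulate; sum)
open import Data.Vec.Properties using (lookup∘tabulate; tabulate∘lookup; tabulate-cong)
open import Data.Rational as ℚ using (ℚ; mkℚ; 0ℚ; 1ℚ) renaming (_≤_ to _≤ℚ_)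
open import Function.Bundles using (_⇔_; mk⇔)
import Data.Rational.Properties as ℚₚ
open import Data.Nat.Coprimality as Coprimality using (1-coprimeTo)
open import Function.Base using (_∘_; id)
open import Data.Product as Product using (_,_; _×_; proj₁; proj₂; ∃-syntax)
open import Relation.Nullary using (yes; no; contradiction)
open import Relation.Binary.PropositionalEquality
  using (_≡_; _≢_; refl; sym; trans; cong; cong₂; subst; module ≡-Reasoning)

module ℕΣ = SemiringSum ℕₚ.+-*-semiring
module ℚΣ = SemiringSum (Ring.semiring ℚₚ.+-*-ring)

module _ {c ℓ} (M : CommutativeMonoid c ℓ) where
  open CommutativeMonoid M using (Carrier; _≈_; _∙_; ε; ∙-congˡ; identityʳ; setoid)
  open CommutativeMonoidSum M using (sum-remove; sum-cong-≋; sum-replicate-zero)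
    renaming (sum to ∑)
  open import Relation.Binary.Reasoning.Setoid setoid

  ∑-pick : ∀ {n} (t : Fin n → Carrier) i → (∀ l → l ≢ i → t l ≈ ε) → ∑ t ≈ t i
  ∑-pick {suc n} t i off = begin
    ∑ t                     ≈⟨ sum-remove t ⟩
    t i ∙ ∑ (t ∘ punchIn i) ≈⟨ ∙-congˡ (sum-cong-≋ (λ l → off (punchIn i l) (punchInᵢ≢i i l))) ⟩
    t i ∙ ∑ {n} (λ _ → ε)   ≈⟨ ∙-congˡ (sum-replicate-zero n) ⟩
    t i ∙ ε                 ≈⟨ identityʳ (t i) ⟩
    t i                     ∎

sum≡∑lookup : ∀ {n} (x : Vec ℕ n) → sum x ≡ ℕΣ.sum (lookup x)
sum≡∑lookup []       = refl
sum≡∑lookup (a ∷ xs) = cong (a +_) (sum≡∑lookup xs)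

Σℚ≡sum : ∀ {n} (f : Fin n → ℚ) → Σℚ f ≡ ℚΣ.sum f
Σℚ≡sum {zero}  f = refl
Σℚ≡sum {suc n} f = cong (f zero ℚ.+_) (Σℚ≡sum (f ∘ suc))

-- Once both arguments are in this normal form, ℚ._+_ and ℚ._*_ compute to a quotient by 1.
ℕtoℚ≡mkℚ : ∀ m → ℕtoℚ m ≡ mkℚ (ℤ.+ m) 0 (Coprimality.sym (1-coprimeTo m))
ℕtoℚ≡mkℚ m = ℚₚ.normalize-coprime (Coprimality.sym (1-coprimeTo m))

ℕtoℚ-+ : ∀ a b → ℕtoℚ (a + b) ≡ ℕtoℚ a ℚ.+ ℕtoℚ b
ℕtoℚ-+ a b = begin
  ℤ.+ (a + b) ℚ./ 1                           ≡⟨ cong (ℚ._/ 1) (ℤₚ.pos-+ a b) ⟩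
  (ℤ.+ a ℤ.+ ℤ.+ b) ℚ./ 1
    ≡⟨ cong₂ (λ p q → (p ℤ.+ q) ℚ./ 1) (ℤₚ.*-identityʳ (ℤ.+ a)) (ℤₚ.*-identityʳ (ℤ.+ b)) ⟨
  (ℤ.+ a ℤ.* ℤ.+ 1 ℤ.+ ℤ.+ b ℤ.* ℤ.+ 1) ℚ./ 1 ≡⟨ cong₂ ℚ._+_ (ℕtoℚ≡mkℚ a) (ℕtoℚ≡mkℚ b) ⟨
  ℕtoℚ a ℚ.+ ℕtoℚ b                           ∎
  where open ≡-Reasoning

ℕtoℚ-* : ∀ a b → ℕtoℚ (a * b) ≡ ℕtoℚ a ℚ.* ℕtoℚ b
ℕtoℚ-* a b = begin
  ℤ.+ (a * b) ℚ./ 1       ≡⟨ cong (ℚ._/ 1) (ℤₚ.pos-* a b) ⟩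
  (ℤ.+ a ℤ.* ℤ.+ b) ℚ./ 1 ≡⟨ cong₂ ℚ._*_ (ℕtoℚ≡mkℚ a) (ℕtoℚ≡mkℚ b) ⟨
  ℕtoℚ a ℚ.* ℕtoℚ b       ∎
  where open ≡-Reasoning

ℕtoℚ-sum : ∀ {n} (f : Fin n → ℕ) → ℕtoℚ (ℕΣ.sum f) ≡ ℚΣ.sum (ℕtoℚ ∘ f)
ℕtoℚ-sum {zero}  f = refl
ℕtoℚ-sum {suc n} f = trans (ℕtoℚ-+ (f zero) _) (cong (ℕtoℚ (f zero) ℚ.+_) (ℕtoℚ-sum (f ∘ suc)))

δ-refl : ∀ {n} (i : Fin n) → δ i i ≡ 1
δ-refl i with i ≟ i
... | yes _   = refl
... | no  i≢i = contradiction refl i≢i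

δ-≢ : ∀ {n} {i j : Fin n} → i ≢ j → δ i j ≡ 0
δ-≢ {i = i} {j} i≢j with i ≟ j
... | yes i≡j = contradiction i≡j i≢j
... | no  _   = refl

∑-δ-* : ∀ {n} (i : Fin n) (w : Fin n → ℕ) → ℕΣ.sum (λ l → δ i l * w l) ≡ w i
∑-δ-* i w = begin
  ℕΣ.sum (λ l → δ i l * w l) ≡⟨ ∑-pick ℕₚ.+-0-commutativeMonoid (λ l → δ i l * w l) i off ⟩
  δ i i * w i                ≡⟨ cong (_* w i) (δ-refl i) ⟩
  1 * w i                    ≡⟨ ℕₚ.*-identityˡ (w i) ⟩
  w i                        ∎
  where
  open ≡-Reasoning
  off : ∀ l → l ≢ i → δ i l * w l ≡ 0
  off l l≢i = cong (_* w l) (δ-≢ (l≢i ∘ sym))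

weight : ∀ {n} → Vec ℕ n → (Fin n → ℕ) → ℕ
weight x w = ℕΣ.sum (λ l → lookup x l * w l)

move : ∀ {n} → Vec ℕ n → Fin n → Fin n → Vec ℕ n
move x i i' = tabulate (λ l → (lookup x l ∸ δ i l) + δ i' l)

δ≤lookup : ∀ {n} (x : Vec ℕ n) {i} l → 1 ≤ lookup x i → δ i l ≤ lookup x l
δ≤lookup x {i} l 1≤xᵢ with i ≟ l
... | yes refl = 1≤xᵢ
... | no  _    = z≤n

weight-move : ∀ {n} (x : Vec ℕ n) {i} i' → 1 ≤ lookup x i → (w : Fin n → ℕ) →
  weight (move x i i') w + w i ≡ weight x w + w i'
weight-move x {i} i' 1≤xᵢ w = begin
  weight (move x i i') w + w i
    ≡⟨ cong (weight (move x i i') w +_) (∑-δ-* i w) ⟨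
  weight (move x i i') w + ℕΣ.sum (λ l → δ i l * w l)
    ≡⟨ ℕΣ.∑-distrib-+ (λ l → lookup (move x i i') l * w l) (λ l → δ i l * w l) ⟨
  ℕΣ.sum (λ l → lookup (move x i i') l * w l + δ i l * w l)
    ≡⟨ ℕΣ.sum-cong-≗ moved ⟩
  ℕΣ.sum (λ l → lookup x l * w l + δ i' l * w l)
    ≡⟨ ℕΣ.∑-distrib-+ (λ l → lookup x l * w l) (λ l → δ i' l * w l) ⟩
  weight x w + ℕΣ.sum (λ l → δ i' l * w l)
    ≡⟨ cong (weight x w +_) (∑-δ-* i' w) ⟩
  weight x w + w i' ∎
  where
  open ≡-Reasoning
  swap-summands : ∀ a b c d → (a + b) * d + c * d ≡ (a + c) * d + b * d
  swap-summands = solve-∀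
  moved : ∀ l → lookup (move x i i') l * w l + δ i l * w l ≡ lookup x l * w l + δ i' l * w l
  moved l = begin
    lookup (move x i i') l * w l + δ i l * w l
      ≡⟨ cong (λ t → t * w l + δ i l * w l) (lookup∘tabulate _ l) ⟩
    ((lookup x l ∸ δ i l) + δ i' l) * w l + δ i l * w l
      ≡⟨ swap-summands (lookup x l ∸ δ i l) (δ i' l) (δ i l) (w l) ⟩
    ((lookup x l ∸ δ i l) + δ i l) * w l + δ i' l * w l
      ≡⟨ cong (λ t → t * w l + δ i' l * w l) (ℕₚ.m∸n+n≡m (δ≤lookup x l 1≤xᵢ)) ⟩
    lookup x l * w l + δ i' l * w l ∎

sum≡weight1 : ∀ {n} (x : Vec ℕ n) → sum x ≡ weight x (λ _ → 1)
sum≡weight1 x = trans (sum≡∑lookup x) (ℕΣ.sum-cong-≗ (λ l → sym (ℕₚ.*-identityʳ (lookup x l))))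

STAdj-sum : ∀ {n} (G : SimpleGraph n) {x y} → STAdj G x y → sum y ≡ sum x
STAdj-sum G {x} (i , i' , _ , 1≤xᵢ , refl) = begin
  sum (move x i i')              ≡⟨ sum≡weight1 (move x i i') ⟩
  weight (move x i i') (λ _ → 1) ≡⟨ ℕₚ.+-cancelʳ-≡ 1 _ _ (weight-move x i' 1≤xᵢ (λ _ → 1)) ⟩
  weight x (λ _ → 1)             ≡⟨ sum≡weight1 x ⟨
  sum x                          ∎
  where open ≡-Reasoning

∑≡0⇒≡0 : ∀ {n} (f : Fin n → ℕ) → ℕΣ.sum f ≡ 0 → ∀ l → f l ≡ 0
∑≡0⇒≡0 f ∑f≡0 zero    = ℕₚ.m+n≡0⇒m≡0 (f zero) ∑f≡0
∑≡0⇒≡0 f ∑f≡0 (suc l) = ∑≡0⇒≡0 (f ∘ suc) (ℕₚ.m+n≡0⇒n≡0 (f zero) ∑f≡0) l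

∑≢0⇒∃≢0 : ∀ {n} (f : Fin n → ℕ) {N} → ℕΣ.sum f ≡ suc N → ∃[ l ] NonZero (f l)
∑≢0⇒∃≢0 {suc n} f ∑f≡1+N with f zero in f₀≡
... | suc _ = zero , subst NonZero (sym f₀≡) _
... | zero  = Product.map suc id (∑≢0⇒∃≢0 (f ∘ suc) ∑f≡1+N)

IsDist-unique : ∀ {A : Set} {R : A → A → Set} {a b d d'} → IsDist R a b d → IsDist R a b d' → d ≡ d'
IsDist-unique (walk , minimal) (walk' , minimal') = ℕₚ.≤-antisym (minimal _ walk') (minimal' _ walk)

potential : ∀ {n} → (Fin n → Fin n → ℕ) → Fin n → Vec ℕ n → ℕ
potential D j x = weight x (λ l → D l j)

module Potential {n} (G : SimpleGraph n) {D : Fin n → Fin n → ℕ}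
                 (isD : IsDistanceMatrix G D) (j : Fin n) where

  Φ : Vec ℕ n → ℕ
  Φ = potential D j

  D-adj : ∀ {i i'} → Adj G i i' → D i j ≤ suc (D i' j)
  D-adj {i} {i'} i~i' = proj₂ (isD i j) _ (step i~i' (proj₁ (isD i' j)))

  D-diag : D j j ≡ 0
  D-diag = ℕₚ.n≤0⇒n≡0 (proj₂ (isD j j) 0 here)

  D≡0⇒≡ : ∀ {l} → D l j ≡ 0 → l ≡ j
  D≡0⇒≡ {l} Dlj≡0 = endpoints (subst (Walk (Adj G) l j) Dlj≡0 (proj₁ (isD l j)))
    where
    endpoints : ∀ {a b} → Walk (Adj G) a b 0 → a ≡ b
    endpoints here = refl

  D-geodesic : ∀ {l d} → D l j ≡ suc d → ∃[ c ] (Adj G l c × D c j ≡ d)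
  D-geodesic {l} {d} Dlj≡1+d with subst (Walk (Adj G) l j) Dlj≡1+d (proj₁ (isD l j))
  ... | step {b = c} l~c walk = c , l~c ,
    ℕₚ.≤-antisym (proj₂ (isD c j) d walk) (s≤s⁻¹ (subst (_≤ suc (D c j)) Dlj≡1+d (D-adj l~c)))

  potential-move : ∀ x {i} i' → 1 ≤ lookup x i →
    Φ (move x i i') + D i j ≡ Φ x + D i' j
  potential-move x i' 1≤xᵢ = weight-move x i' 1≤xᵢ (λ l → D l j)

  potential-STAdj : ∀ {x y} → STAdj G x y → Φ x ≤ suc (Φ y)
  potential-STAdj {x} (i , i' , i~i' , 1≤xᵢ , refl) = ℕₚ.+-cancelʳ-≤ (D i' j) _ _ (begin
    Φ x + D i' j                   ≡⟨ potential-move x i' 1≤xᵢ ⟨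
    Φ (move x i i') + D i j        ≤⟨ ℕₚ.+-monoʳ-≤ (Φ (move x i i')) (D-adj i~i') ⟩
    Φ (move x i i') + suc (D i' j) ≡⟨ ℕₚ.+-suc _ _ ⟩
    suc (Φ (move x i i') + D i' j) ∎)
    where open ℕₚ.≤-Reasoning

  potential-zvec : ∀ k → Φ (zvec k j) ≡ 0
  potential-zvec k = begin
    ℕΣ.sum (λ l → lookup (zvec k j) l * D l j) ≡⟨ ℕΣ.sum-cong-≗ reorder ⟩
    ℕΣ.sum (λ l → δ j l * (k * D l j))         ≡⟨ ∑-δ-* j (λ l → k * D l j) ⟩
    k * D j j                                  ≡⟨ cong (k *_) D-diag ⟩
    k * 0                                      ≡⟨ ℕₚ.*-zeroʳ k ⟩
    0                                          ∎
    where
    open ≡-Reasoning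
    reorder : ∀ l → lookup (zvec k j) l * D l j ≡ δ j l * (k * D l j)
    reorder l = begin
      lookup (zvec k j) l * D l j ≡⟨ cong (_* D l j) (lookup∘tabulate _ l) ⟩
      k * δ j l * D l j           ≡⟨ cong (_* D l j) (ℕₚ.*-comm k (δ j l)) ⟩
      δ j l * k * D l j           ≡⟨ ℕₚ.*-assoc (δ j l) k (D l j) ⟩
      δ j l * (k * D l j)         ∎

  potential≤length : ∀ {k x m} → Walk (STAdj G) x (zvec k j) m → Φ x ≤ m
  potential≤length {k} here = ℕₚ.≤-reflexive (potential-zvec k)
  potential≤length {k} {x} (step {b = y} x~y walk) =
    ℕₚ.≤-trans (potential-STAdj {x} {y} x~y) (s≤s (potential≤length {k} walk))

  potential≡0⇒zvec : ∀ {k} x → Φ x ≡ 0 → sum x ≡ k → x ≡ zvec k j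
  potential≡0⇒zvec {k} x Φx≡0 Σx≡k = trans (sym (tabulate∘lookup x)) (tabulate-cong coordinate)
    where
    off : ∀ l → l ≢ j → lookup x l ≡ 0
    off l l≢j = ℕₚ.m*n≡0⇒m≡0 (lookup x l) (D l j) ⦃ ℕ.≢-nonZero (l≢j ∘ D≡0⇒≡) ⦄
                  (∑≡0⇒≡0 (λ l → lookup x l * D l j) Φx≡0 l)
    xⱼ≡k : lookup x j ≡ k
    xⱼ≡k = begin
      lookup x j            ≡⟨ ∑-pick ℕₚ.+-0-commutativeMonoid (lookup x) j off ⟨
      ℕΣ.sum (lookup x)     ≡⟨ sum≡∑lookup x ⟨
      sum x                 ≡⟨ Σx≡k ⟩
      k                     ∎
      where open ≡-Reasoning
    coordinate : ∀ l → lookup x l ≡ k * δ j l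
    coordinate l with j ≟ l
    ... | yes refl = trans xⱼ≡k (sym (ℕₚ.*-identityʳ k))
    ... | no  j≢l  = trans (off l (j≢l ∘ sym)) (sym (ℕₚ.*-zeroʳ k))

  potential-support : ∀ x {N} → Φ x ≡ suc N → ∃[ l ] (1 ≤ lookup x l × ∃[ d ] D l j ≡ suc d)
  potential-support x Φx≡1+N with ∑≢0⇒∃≢0 (λ l → lookup x l * D l j) Φx≡1+N
  ... | l , xₗDₗ≢0 = l , ℕ.>-nonZero⁻¹ (lookup x l) ⦃ ℕₚ.m*n≢0⇒m≢0 (lookup x l) ⦃ xₗDₗ≢0 ⦄ ⦄ ,
                     ℕ.pred (D l j) , sym (ℕₚ.suc-pred (D l j) ⦃ ℕₚ.m*n≢0⇒n≢0 (lookup x l) ⦃ xₗDₗ≢0 ⦄ ⦄)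

  potential-descent : ∀ x {N} → Φ x ≡ suc N → ∃[ y ] (STAdj G x y × Φ y ≡ N)
  potential-descent x {N} Φx≡1+N with potential-support x Φx≡1+N
  ... | l , 1≤xₗ , d , Dₗ≡1+d with D-geodesic Dₗ≡1+d
  ...   | c , l~c , D꜀≡d = move x l c , (l , c , l~c , 1≤xₗ , refl) , ℕₚ.+-cancelʳ-≡ _ _ _ (begin
    Φ (move x l c) + D l j ≡⟨ potential-move x c 1≤xₗ ⟩
    Φ x + D c j            ≡⟨ cong₂ _+_ Φx≡1+N D꜀≡d ⟩
    suc N + d              ≡⟨ ℕₚ.+-suc N d ⟨
    N + suc d              ≡⟨ cong (N +_) Dₗ≡1+d ⟨
    N + D l j              ∎)
    where open ≡-Reasoning

  walk-of-potential : ∀ {k} N x → Φ x ≡ N → sum x ≡ k → Walk (STAdj G) x (zvec k j) N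
  walk-of-potential zero x Φx≡0 Σx≡k =
    subst (λ z → Walk (STAdj G) x z 0) (potential≡0⇒zvec x Φx≡0 Σx≡k) here
  walk-of-potential (suc N) x Φx≡1+N Σx≡k with potential-descent x Φx≡1+N
  ... | y , x~y , Φy≡N =
    step x~y (walk-of-potential N y Φy≡N (trans (STAdj-sum G {x} {y} x~y) Σx≡k))

  dist-potential : ∀ {k} x → sum x ≡ k → IsDist (STAdj G) x (zvec k j) (Φ x)
  dist-potential {k} x Σx≡k = walk-of-potential (Φ x) x refl Σx≡k , λ _ → potential≤length {k}

Σℚ-cong : ∀ {n} {f g : Fin n → ℚ} → (∀ i → f i ≡ g i) → Σℚ f ≡ Σℚ g
Σℚ-cong {f = f} {g} f≗g = trans (Σℚ≡sum f) (trans (ℚΣ.sum-cong-≗ f≗g) (sym (Σℚ≡sum g)))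

Σℚ-*ˡ : ∀ {n} c (f : Fin n → ℚ) → Σℚ (λ i → c ℚ.* f i) ≡ c ℚ.* Σℚ f
Σℚ-*ˡ c f = trans (Σℚ≡sum (λ i → c ℚ.* f i))
  (trans (sym (ℚΣ.*-distribˡ-sum c f)) (cong (c ℚ.*_) (sym (Σℚ≡sum f))))

Σℚ-*ʳ : ∀ {n} c (f : Fin n → ℚ) → Σℚ (λ i → f i ℚ.* c) ≡ Σℚ f ℚ.* c
Σℚ-*ʳ c f = trans (Σℚ≡sum (λ i → f i ℚ.* c))
  (trans (sym (ℚΣ.*-distribʳ-sum c f)) (cong (ℚ._* c) (sym (Σℚ≡sum f))))

Σℚ-comm : ∀ {n m} (f : Fin n → Fin m → ℚ) → Σℚ (λ i → Σℚ (f i)) ≡ Σℚ (λ l → Σℚ (λ i → f i l))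
Σℚ-comm f = begin
  Σℚ (λ i → Σℚ (f i))                   ≡⟨ Σℚ-cong (λ i → Σℚ≡sum (f i)) ⟩
  Σℚ (λ i → ℚΣ.sum (f i))               ≡⟨ Σℚ≡sum (λ i → ℚΣ.sum (f i)) ⟩
  ℚΣ.sum (λ i → ℚΣ.sum (f i))           ≡⟨ ℚΣ.∑-comm f ⟩
  ℚΣ.sum (λ l → ℚΣ.sum (λ i → f i l))   ≡⟨ Σℚ≡sum (λ l → ℚΣ.sum (λ i → f i l)) ⟨
  Σℚ (λ l → ℚΣ.sum (λ i → f i l))       ≡⟨ Σℚ-cong (λ l → Σℚ≡sum (λ i → f i l)) ⟨
  Σℚ (λ l → Σℚ (λ i → f i l))           ∎
  where open ≡-Reasoning

_⋆_ : ∀ {n} → (Fin n → Fin n → ℚ) → (Fin n → Fin n → ℚ) → (Fin n → Fin n → ℚ)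
(M ⋆ N) i j = Σℚ (λ l → M i l ℚ.* N l j)

·ᵣ-cong : ∀ {n} {ρ σ : Fin n → ℚ} (M : Fin n → Fin n → ℚ) → (∀ i → ρ i ≡ σ i) →
  ∀ j → (ρ ·ᵣ M) j ≡ (σ ·ᵣ M) j
·ᵣ-cong M ρ≗σ j = Σℚ-cong (λ i → cong (ℚ._* M i j) (ρ≗σ i))

·ᵣ-assoc : ∀ {n} (ρ : Fin n → ℚ) (M N : Fin n → Fin n → ℚ) j →
  ((ρ ·ᵣ M) ·ᵣ N) j ≡ (ρ ·ᵣ (M ⋆ N)) j
·ᵣ-assoc ρ M N j = begin
  Σℚ (λ l → Σℚ (λ i → ρ i ℚ.* M i l) ℚ.* N l j)   ≡⟨ Σℚ-cong (λ l → Σℚ-*ʳ (N l j) (λ i → ρ i ℚ.* M i l)) ⟨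
  Σℚ (λ l → Σℚ (λ i → ρ i ℚ.* M i l ℚ.* N l j))   ≡⟨ Σℚ-comm (λ i l → ρ i ℚ.* M i l ℚ.* N l j) ⟨
  Σℚ (λ i → Σℚ (λ l → ρ i ℚ.* M i l ℚ.* N l j))   ≡⟨ Σℚ-cong (λ i → Σℚ-cong (λ l → ℚₚ.*-assoc (ρ i) (M i l) (N l j))) ⟩
  Σℚ (λ i → Σℚ (λ l → ρ i ℚ.* (M i l ℚ.* N l j))) ≡⟨ Σℚ-cong (λ i → Σℚ-*ˡ (ρ i) (λ l → M i l ℚ.* N l j)) ⟩
  Σℚ (λ i → ρ i ℚ.* (M ⋆ N) i j)                  ∎
  where open ≡-Reasoning

·ᵣ-δℚ : ∀ {n} (ρ : Fin n → ℚ) j → (ρ ·ᵣ δℚ) j ≡ ρ j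
·ᵣ-δℚ ρ j = begin
  Σℚ (λ i → ρ i ℚ.* δℚ i j)     ≡⟨ Σℚ≡sum (λ i → ρ i ℚ.* δℚ i j) ⟩
  ℚΣ.sum (λ i → ρ i ℚ.* δℚ i j) ≡⟨ ∑-pick ℚₚ.+-0-commutativeMonoid _ j off ⟩
  ρ j ℚ.* δℚ j j                ≡⟨ cong (λ d → ρ j ℚ.* ℕtoℚ d) (δ-refl j) ⟩
  ρ j ℚ.* 1ℚ                    ≡⟨ ℚₚ.*-identityʳ (ρ j) ⟩
  ρ j                           ∎
  where
  open ≡-Reasoning
  off : ∀ i → i ≢ j → ρ i ℚ.* δℚ i j ≡ 0ℚ
  off i i≢j = trans (cong (λ d → ρ i ℚ.* ℕtoℚ d) (δ-≢ i≢j)) (ℚₚ.*-zeroʳ (ρ i))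

·ᵣ-cancel : ∀ {n} {M N : Fin n → Fin n → ℚ} → (∀ i j → (M ⋆ N) i j ≡ δℚ i j) →
  ∀ (ρ : Fin n → ℚ) j → ((ρ ·ᵣ M) ·ᵣ N) j ≡ ρ j
·ᵣ-cancel {M = M} {N} M⋆N≡I ρ j = begin
  ((ρ ·ᵣ M) ·ᵣ N) j ≡⟨ ·ᵣ-assoc ρ M N j ⟩
  (ρ ·ᵣ (M ⋆ N)) j  ≡⟨ Σℚ-cong (λ i → cong (ρ i ℚ.*_) (M⋆N≡I i j)) ⟩
  (ρ ·ᵣ δℚ) j       ≡⟨ ·ᵣ-δℚ ρ j ⟩
  ρ j               ∎
  where open ≡-Reasoning

potential-ℚ : ∀ {n} (D : Fin n → Fin n → ℕ) x j →
  ℕtoℚ (potential D j x) ≡ ((ℕtoℚ ∘ lookup x) ·ᵣ (λ i l → ℕtoℚ (D i l))) j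
potential-ℚ D x j = begin
  ℕtoℚ (ℕΣ.sum (λ l → lookup x l * D l j))          ≡⟨ ℕtoℚ-sum (λ l → lookup x l * D l j) ⟩
  ℚΣ.sum (λ l → ℕtoℚ (lookup x l * D l j))          ≡⟨ ℚΣ.sum-cong-≗ (λ l → ℕtoℚ-* (lookup x l) (D l j)) ⟩
  ℚΣ.sum (λ l → ℕtoℚ (lookup x l) ℚ.* ℕtoℚ (D l j)) ≡⟨ Σℚ≡sum (λ l → ℕtoℚ (lookup x l) ℚ.* ℕtoℚ (D l j)) ⟨
  Σℚ (λ l → ℕtoℚ (lookup x l) ℚ.* ℕtoℚ (D l j))     ∎
  where open ≡-Reasoning

mainTheorem8 : ∀ {n : ℕ} (G : SimpleGraph n) (D : Fin n → Fin n → ℕ) (Dinv : Fin n → Fin n → ℚ) (k : ℕ)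
    → Connected G → IsDistanceMatrix G D → IsInverse D Dinv → 1 ≤ k
    → (ρ : Fin n → ℚ) → (∀ j → 0ℚ ≤ℚ ρ j)
    → Feasible G k ρ ⇔ (∃[ m ] ((∀ j → (ρ ·ᵣ Dinv) j ≡ ℕtoℚ (lookup m j)) × sum m ≡ k))
-- Connectivity already follows from IsDistanceMatrix.
mainTheorem8 G D Dinv k _ isD (D⋆Dinv≡I , Dinv⋆D≡I) _ ρ _ = mk⇔ feasible⇒integral integral⇒feasible
  where
  open Potential G isD using (dist-potential)
  DQ : Fin _ → Fin _ → ℚ
  DQ i l = ℕtoℚ (D i l)

  feasible⇒integral : Feasible G k ρ → ∃[ m ] ((∀ j → (ρ ·ᵣ Dinv) j ≡ ℕtoℚ (lookup m j)) × sum m ≡ k)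
  feasible⇒integral (x , Σx≡k , dist) = x , ρDinv≡x , Σx≡k
    where
    ρ≡xD : ∀ j → ρ j ≡ ((ℕtoℚ ∘ lookup x) ·ᵣ DQ) j
    ρ≡xD j with dist j
    ... | d , isDist , ρⱼ≡d = begin
      ρ j                       ≡⟨ ρⱼ≡d ⟩
      ℕtoℚ d                    ≡⟨ cong ℕtoℚ (IsDist-unique isDist (dist-potential j x Σx≡k)) ⟩
      ℕtoℚ (potential D j x)    ≡⟨ potential-ℚ D x j ⟩
      ((ℕtoℚ ∘ lookup x) ·ᵣ DQ) j ∎
      where open ≡-Reasoning
    ρDinv≡x : ∀ j → (ρ ·ᵣ Dinv) j ≡ ℕtoℚ (lookup x j)
    ρDinv≡x j = trans (·ᵣ-cong Dinv ρ≡xD j) (·ᵣ-cancel D⋆Dinv≡I (ℕtoℚ ∘ lookup x) j)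

  integral⇒feasible : ∃[ m ] ((∀ j → (ρ ·ᵣ Dinv) j ≡ ℕtoℚ (lookup m j)) × sum m ≡ k) → Feasible G k ρ
  integral⇒feasible (m , ρDinv≡m , Σm≡k) =
    m , Σm≡k , λ j → potential D j m , dist-potential j m Σm≡k , ρ≡mD j
    where
    ρ≡mD : ∀ j → ρ j ≡ ℕtoℚ (potential D j m)
    ρ≡mD j = begin
      ρ j                         ≡⟨ ·ᵣ-cancel Dinv⋆D≡I ρ j ⟨
      ((ρ ·ᵣ Dinv) ·ᵣ DQ) j       ≡⟨ ·ᵣ-cong DQ ρDinv≡m j ⟩
      ((ℕtoℚ ∘ lookup m) ·ᵣ DQ) j ≡⟨ potential-ℚ D m j ⟨
      ℕtoℚ (potential D j m)      ∎
      where open ≡-Reasoning
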